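{- Let $m,n\geq 2$ and $c_{\mathrm{small}}\geq 0$ be integers and $c_{\mathrm{large}}\geq 2^nc_{\mathrm{small}}$ an integer. Let $T$ be a tournament that contains neither $A_m$ nor $D_n$, such that every subtournament $T'$ of $T$ with $\overrightarrow{\omega}(T')\geq c_{\mathrm{small}}$ contains a copy of $A_{m-1}$ and a copy of $D_{n-1}$. Let $B=(B_1,\dots,B_t)$ be a $(c_{\mathrm{large}},c_{\mathrm{small}})$-$\overrightarrow{\omega}$-bag-chain in $T$ of maximum length, and let $(Z_{1/2},Z_{3/2},\dots,Z_{t-1/2})$ be its zone-sequence. Then for every $i\in\{1,\dots,t\}$, every $j\in\{1/2,3/2,\dots,t-1/2\}$ and every $v\in Z_j$: (a) $\overrightarrow{\omega}(B_i\cap N^+(v))<c_{\mathrm{small}}$ whenever $i<j-1$; and (b) $\overrightarrow{\omega}(B_i\cap N^-(v))<c_{\mathrm{small}}$ whenever $i>j+1$.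
   Context: A tournament is a finite directed graph with exactly one arc between each pair of distinct vertices; $N^+(v)$, $N^-(v)$ denote out- and in-neighbourhoods. For a total ordering $<$ of $V(T)$, the backedge graph $B(T,<)$ is the graph on $V(T)$ with an edge $uv$ for every pair $u<v$ with $vu \in A(T)$; $\overrightarrow{\omega}(T)=\min_<\omega(B(T,<))$ over all total orderings, and for $X\subseteq V(T)$, $\overrightarrow{\omega}(X)=\overrightarrow{\omega}(T[X])$. A tournament contains (a copy of) $H$ if some induced subtournament is isomorphic to $H$. For disjoint vertex sets $X,Y$, $X\Rightarrow Y$ means $xy$ is an arc for all $x\in X,y\in Y$. The tournament $A_1$ is a single vertex; for $k\ge 2$, $A_k$ consists of vertex-disjoint tournaments $T_1,\dots,T_{k-1}$, each isomorphic to $A_{k-1}$, and further vertices $v_1,\dots,v_k$, with: $A_k[V(T_i)]=T_i$; $v_j\Rightarrow v_i$ whenever $i<j$; $V(T_i)\Rightarrow V(T_j)$ whenever $i<j$; $v_i\Rightarrow V(T_j)$ whenever $i\le j$; and $V(T_j)\Rightarrow v_i$ whenever $i>j$. The tournament $D_1$ is a single vertex, and $D_k$ is obtained from two disjoint copies $T_1,T_2$ of $D_{k-1}$ and one further vertex $w$ with $V(T_1)\Rightarrow V(T_2)$, $V(T_2)\Rightarrow w$, $w \Rightarrow V(T_1)$. For integers $c',a$, a $(c',a)$-$\overrightarrow{\omega}$-bag-chain of length $t$ in $T$ is a tuple $(B_1,\dots,B_t)$ of pairwise disjoint subsets of $V(T)$ with $\overrightarrow{\omega}(B_i)=c'$ for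 all $i$, such that for all $1\le i<j\le t$: $\overrightarrow{\omega}(N^+(v)\cap B_i)<a$ for every $v\in B_j$, and $\overrightarrow{\omega}(N^-(w)\cap B_j)<a$ for every $w\in B_i$. The zone-sequence of $B$ is defined as follows: for each $v\in V(T)\setminus\bigcup_i B_i$, put $v$ in $Z_{j-1/2}$ where $j$ is the largest index in $\{1,\dots,t\}$ with $\overrightarrow{\omega}(B_j\cap N^-(v))\geq c_{\mathrm{small}}$, and put $v$ in $Z_{1/2}$ if no such $j$ exists; the zones $Z_{1/2},\dots,Z_{t-1/2}$ thus partition $V(T)\setminus\bigcup_i B_i$. -}

module Defs where

open import Data.Bool using (Bool; true; false; if_then_else_)
open import Data.Nat using (ℕ; zero; suc; _<_; _≤_; _<ᵇ_; _≤ᵇ_; _≡ᵇ_)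
open import Data.Fin using (Fin; toℕ)
open import Data.Fin.Subset using (Subset; _∈_; _∉_; _⊆_; _∩_; ∣_∣; ⊤)
open import Data.Vec using (tabulate)
open import Data.Product using (Σ; _×_; ∃)
open import Data.Sum using (_⊎_)
open import Relation.Nullary using (¬_)
open import Relation.Binary.PropositionalEquality using (_≡_; _≢_)

record Tournament (N : ℕ) : Set where
  field
    arc     : Fin N → Fin N → Bool
    irrefl  : ∀ v → arc v v ≡ false
    total   : ∀ u v → u ≢ v → (arc u v ≡ true) ⊎ (arc v u ≡ true)
    antisym : ∀ u v → arc u v ≡ true → arc v u ≡ false

open Tournament public

module _ {N : ℕ} (T : Tournament N) where

  Arc : Fin N → Fin N → Set
  Arc u v = arc T u v ≡ true

  N⁺ : Fin N → Subset N
  N⁺ v = tabulate (λ u → arc T v u)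

  N⁻ : Fin N → Subset N
  N⁻ v = tabulate (λ u → arc T u v)

  -- A total ordering of X, given by a rank function injective on X
  -- (u < v iff rank u < rank v).
  IsOrdering : Subset N → (Fin N → ℕ) → Set
  IsOrdering X rank = ∀ u v → u ∈ X → v ∈ X → rank u ≡ rank v → u ≡ v

  -- K is a clique of the backedge graph B(T[X], <):
  -- every pair u < v in K satisfies vu ∈ A(T).
  BackClique : Subset N → (Fin N → ℕ) → Subset N → Set
  BackClique X rank K =
    K ⊆ X × (∀ u v → u ∈ K → v ∈ K → rank u < rank v → Arc v u)

  -- ω⃗(X) < a : some ordering of X has backedge clique number < a
  ωLt : Subset N → ℕ → Set
  ωLt X a = Σ (Fin N → ℕ) λ rank → IsOrdering X rank ×
            (∀ K → BackClique X rank K → ∣ K ∣ < a)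

  ωGe : Subset N → ℕ → Set
  ωGe X c = ∀ rank → IsOrdering X rank →
            Σ (Subset N) λ K → BackClique X rank K × c ≤ ∣ K ∣

  ωEq : Subset N → ℕ → Set
  ωEq X c = ωGe X c × ωLt X (suc c)

  ContainsIn : Subset N → {V : Set} → (V → V → Bool) → Set
  ContainsIn X {V} arcH = Σ (V → Fin N) λ f →
    (∀ x y → f x ≡ f y → x ≡ y) × (∀ x → f x ∈ X) ×
    (∀ x y → arcH x y ≡ arc T (f x) (f y))

  Contains : {V : Set} → (V → V → Bool) → Set
  Contains arcH = ContainsIn ⊤ arcH

-- The tournaments A_k (k ≥ 1)
-- Vertices of A_{k+2}: inT i x  (x in the copy T_{i+1} of A_{k+1}, i : Fin (k+1))
--                      vtx i    (the vertex v_{i+1}, i : Fin (k+2))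

data AV : ℕ → Set where
  a1  : AV 1
  inT : ∀ {k} → Fin (suc k) → AV (suc k) → AV (suc (suc k))
  vtx : ∀ {k} → Fin (suc (suc k)) → AV (suc (suc k))

arcA : ∀ {k} → AV k → AV k → Bool
arcA a1 a1 = false
arcA (inT i x) (inT j y) =
  if toℕ i ≡ᵇ toℕ j then arcA x y else toℕ i <ᵇ toℕ j
arcA (vtx i) (vtx j) = toℕ j <ᵇ toℕ i
arcA (vtx i) (inT j y) = toℕ i ≤ᵇ toℕ j
arcA (inT j y) (vtx i) = toℕ j <ᵇ toℕ i

A : (k : ℕ) → AV k → AV k → Bool
A k = arcA {k}

data DV : ℕ → Set where
  d1    : DV 1
  left  : ∀ {k} → DV (suc k) → DV (suc (suc k))
  right : ∀ {k} → DV (suc k) → DV (suc (suc k))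
  w     : ∀ {k} → DV (suc (suc k))

arcD : ∀ {k} → DV k → DV k → Bool
arcD d1 d1 = false
arcD (left x) (left y) = arcD x y
arcD (right x) (right y) = arcD x y
arcD (left x) (right y) = true
arcD (right x) (left y) = false
arcD (right x) w = true
arcD w (right y) = false
arcD w (left y) = true
arcD (left x) w = false
arcD w w = false

D : (k : ℕ) → DV k → DV k → Bool
D k = arcD {k}

-- Bag-chains (bags indexed 0-based: B i stands for B_{i+1})

module _ {N : ℕ} (T : Tournament N) where

  IsBagChain : ℕ → ℕ → (t : ℕ) → (Fin t → Subset N) → Set
  IsBagChain c′ a t B =
    (∀ i j v → v ∈ B i → v ∈ B j → i ≡ j) ×
    (∀ i → ωEq T (B i) c′) ×
    (∀ i j → toℕ i < toℕ j →
       (∀ v → v ∈ B j → ωLt T (N⁺ T v ∩ B i) a) ×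
       (∀ w → w ∈ B i → ωLt T (N⁻ T w ∩ B j) a))

  IsMaxBagChain : ℕ → ℕ → (t : ℕ) → (Fin t → Subset N) → Set
  IsMaxBagChain c′ a t B =
    IsBagChain c′ a t B ×
    (∀ t′ (B′ : Fin t′ → Subset N) → IsBagChain c′ a t′ B′ → t′ ≤ t)

  -- zone-sequence: InZone cs t B z v  means  v ∈ Z_{z+1/2}
  -- (z : Fin t, so z+1/2 ranges over 1/2, 3/2, …, t-1/2)
  InZone : ℕ → (t : ℕ) → (Fin t → Subset N) → Fin t → Fin N → Set
  InZone cs t B z v =
    (∀ i → v ∉ B i) ×
    ( (ωGe T (B z ∩ N⁻ T v) cs ×
         (∀ i → toℕ z < toℕ i → ¬ ωGe T (B i ∩ N⁻ T v) cs))
    ⊎ (toℕ z ≡ 0 × (∀ i → ¬ ωGe T (B i ∩ N⁻ T v) cs)))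

-- Part (b) is the definition of the zones once "not ω⃗ ≥ c" is turned into
-- "ω⃗ < c", which is possible because ω⃗(X) < a is decidable.
--
-- For (a), let v ∈ Z_j, i < j − 1, and suppose ω⃗(B_i ∩ N⁺(v)) ≥ c_small.  The
-- bag M = B_{i+1} misses v and has ω⃗(M) ≥ 2ⁿ c_small, and ω⃗ is subadditive, so
-- M ∩ N⁻(v) or M ∩ N⁺(v) has ω⃗ ≥ 2ⁿ⁻¹ c_small.  In the first case take a copy
-- of D_{n-1} in B_i ∩ N⁺(v); each of its 2ⁿ⁻¹ − 1 vertices has in-neighbourhood
-- of ω⃗ < c_small in M, so outside all of them M ∩ N⁻(v) still has ω⃗ ≥ c_small
-- and contains a second copy of D_{n-1}, dominated by the first.  The two copies
-- and v form a D_n.  The second case is symmetric, starting from a copy of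
-- D_{n-1} in B_{j+1/2} ∩ N⁻(v), which has ω⃗ ≥ c_small because v lies in Z_j.

module Submission where

open import Defs
open import Data.Nat using (ℕ; suc; _+_; _*_; _^_; _∸_; _≤_; _<_)
open import Data.Fin using (Fin; toℕ)
open import Data.Fin.Subset using (Subset; _∩_)
open import Data.Product using (_×_)
open import Relation.Nullary using (¬_)

open import Data.Bool using (Bool; true; false)
open import Data.Bool.Properties using () renaming (_≟_ to _≟ᵇ_)
open import Data.Fin using (fromℕ<)
open import Data.Fin.Properties using (any?; all?; toℕ<n; toℕ-fromℕ<) renaming (_≟_ to _≟ᶠ_)
open import Data.Fin.Subset using (_∈_; _∉_; _⊆_; _∪_; ∁; ∣_∣)
open import Data.Fin.Subset.Properties
  using (_∈?_; _⊆?_; anySubset?; ∣p∣≤n; p⊂q⇒∣p∣<∣q∣; ∈⊤; p∩q⊆p; p∩q⊆q; x∈p∩q⁺; x∈p∩q⁻;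
         x∈p∪q⁺; x∈p∪q⁻; x∈∁p⇒x∉p; x∉p⇒x∈∁p)
open import Data.Nat using (zero; s≤s; z<s; _<?_; _≤?_)
open import Data.Nat.Properties
open import Data.Nat.Tactic.RingSolver using (solve-∀)
open import Data.Product using (Σ; ∃; _,_; proj₁; proj₂)
open import Data.Sum using (_⊎_; inj₁; inj₂)
open import Data.Vec using (Vec; []; _∷_; lookup; tabulate)
open import Data.Vec.Properties using (lookup∘tabulate; []=⇒lookup; lookup⇒[]=)
open import Function using (_∘_)
open import Relation.Binary.Definitions using (tri<; tri≈; tri>)
open import Relation.Binary.PropositionalEquality
  using (_≡_; _≢_; refl; sym; trans; cong; subst; subst₂)
open import Relation.Nullary using (Dec; yes; no; does; ¬?; contradiction)
open import Relation.Nullary.Decidable using (_×-dec_; _→-dec_; map′; dec-true)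

∈-tabulate⁺ : ∀ {n} {f : Fin n → Bool} {u} → f u ≡ true → u ∈ tabulate f
∈-tabulate⁺ {f = f} {u} fu = lookup⇒[]= u (tabulate f) (trans (lookup∘tabulate f u) fu)

∈-tabulate⁻ : ∀ {n} {f : Fin n → Bool} {u} → u ∈ tabulate f → f u ≡ true
∈-tabulate⁻ {f = f} {u} u∈ = trans (sym (lookup∘tabulate f u)) ([]=⇒lookup u∈)

decSubset : ∀ {n} {P : Fin n → Set} → (∀ u → Dec (P u)) → Subset n
decSubset P? = tabulate (λ u → does (P? u))

∈-decSubset⁺ : ∀ {n} {P : Fin n → Set} (P? : ∀ u → Dec (P u)) {u} → P u → u ∈ decSubset P?
∈-decSubset⁺ P? {u} p = ∈-tabulate⁺ (dec-true (P? u) p)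

∈-decSubset⁻ : ∀ {n} {P : Fin n → Set} (P? : ∀ u → Dec (P u)) {u} → u ∈ decSubset P? → P u
∈-decSubset⁻ P? {u} u∈ with P? u | ∈-tabulate⁻ {f = λ u → does (P? u)} u∈
... | yes p | _ = p
... | no _  | ()

x∈p∪q∧x∉p⇒x∈q : ∀ {n} {p q : Subset n} {x} → x ∈ p ∪ q → x ∉ p → x ∈ q
x∈p∪q∧x∉p⇒x∈q {p = p} {q} x∈ x∉p with x∈p∪q⁻ p q x∈
... | inj₁ x∈p = contradiction x∈p x∉p
... | inj₂ x∈q = x∈q

p⊆q∪p∩∁q : ∀ {n} (p q : Subset n) → p ⊆ q ∪ (p ∩ ∁ q)
p⊆q∪p∩∁q p q {x} x∈p with x ∈? q
... | yes x∈q = x∈p∪q⁺ (inj₁ x∈q)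
... | no x∉q = x∈p∪q⁺ (inj₂ (x∈p∩q⁺ (x∈p , x∉p⇒x∈∁p x∉q)))

∩-monoʳ-⊆ : ∀ {n} (p : Subset n) {q r} → q ⊆ r → p ∩ q ⊆ p ∩ r
∩-monoʳ-⊆ p {q} q⊆r x∈ = let (x∈p , x∈q) = x∈p∩q⁻ p q x∈ in x∈p∩q⁺ (x∈p , q⊆r x∈q)

∣p∣≡∣p∩q∣+∣p∩∁q∣ : ∀ {n} (p q : Subset n) → ∣ p ∣ ≡ ∣ p ∩ q ∣ + ∣ p ∩ ∁ q ∣
∣p∣≡∣p∩q∣+∣p∩∁q∣ [] [] = refl
∣p∣≡∣p∩q∣+∣p∩∁q∣ (true ∷ p) (true ∷ q) = cong suc (∣p∣≡∣p∩q∣+∣p∩∁q∣ p q)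
∣p∣≡∣p∩q∣+∣p∩∁q∣ (true ∷ p) (false ∷ q) =
  trans (cong suc (∣p∣≡∣p∩q∣+∣p∩∁q∣ p q)) (sym (+-suc _ _))
∣p∣≡∣p∩q∣+∣p∩∁q∣ (false ∷ p) (true ∷ q) = ∣p∣≡∣p∩q∣+∣p∩∁q∣ p q
∣p∣≡∣p∩q∣+∣p∩∁q∣ (false ∷ p) (false ∷ q) = ∣p∣≡∣p∩q∣+∣p∩∁q∣ p q

anyVec? : ∀ {m n} {P : Vec (Fin m) n → Set} → (∀ r → Dec (P r)) → Dec (∃ P)
anyVec? {n = zero} P? = map′ ([] ,_) (λ { ([] , p) → p }) (P? [])
anyVec? {n = suc n} P? =
  map′ (λ (x , r , p) → x ∷ r , p) (λ { (x ∷ r , p) → x , r , p })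
       (any? λ x → anyVec? λ r → P? (x ∷ r))

module _ {N : ℕ} (T : Tournament N) where

  Arc⇒≢ : ∀ {u v} → Arc T u v → u ≢ v
  Arc⇒≢ {u} uu refl with trans (sym uu) (irrefl T u)
  ... | ()

  ∈N⁺⇒Arc : ∀ {u v} → u ∈ N⁺ T v → Arc T v u
  ∈N⁺⇒Arc = ∈-tabulate⁻

  ∈N⁻⇒Arc : ∀ {u v} → u ∈ N⁻ T v → Arc T u v
  ∈N⁻⇒Arc = ∈-tabulate⁻

  Arc⇒∈N⁺ : ∀ {u v} → Arc T v u → u ∈ N⁺ T v
  Arc⇒∈N⁺ = ∈-tabulate⁺

  Arc⇒∈N⁻ : ∀ {u v} → Arc T u v → u ∈ N⁻ T v
  Arc⇒∈N⁻ = ∈-tabulate⁺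

  ∉N⁺⇒Arc : ∀ {u v} → u ≢ v → u ∉ N⁺ T v → Arc T u v
  ∉N⁺⇒Arc {u} {v} u≢v u∉ with total T u v u≢v
  ... | inj₁ uv = uv
  ... | inj₂ vu = contradiction (Arc⇒∈N⁺ vu) u∉

  ∉N⁻⇒Arc : ∀ {u v} → u ≢ v → u ∉ N⁻ T v → Arc T v u
  ∉N⁻⇒Arc {u} {v} u≢v u∉ with total T v u (u≢v ∘ sym)
  ... | inj₁ vu = vu
  ... | inj₂ uv = contradiction (Arc⇒∈N⁻ uv) u∉

  N⁺-N⁻-disjoint : ∀ {u u′ v} → u ∈ N⁺ T v → u′ ∈ N⁻ T v → u ≢ u′
  N⁺-N⁻-disjoint {u} {v = v} u∈ u∈′ refl with trans (sym (∈N⁻⇒Arc u∈′)) (antisym T v u (∈N⁺⇒Arc u∈))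
  ... | ()

  ⊆N⁺∪N⁻ : ∀ {X v} → v ∉ X → X ⊆ (X ∩ N⁺ T v) ∪ (X ∩ N⁻ T v)
  ⊆N⁺∪N⁻ {v = v} v∉X {u} u∈X with total T v u (λ { refl → v∉X u∈X })
  ... | inj₁ vu = x∈p∪q⁺ (inj₁ (x∈p∩q⁺ (u∈X , Arc⇒∈N⁺ vu)))
  ... | inj₂ uv = x∈p∪q⁺ (inj₂ (x∈p∩q⁺ (u∈X , Arc⇒∈N⁻ uv)))

  ContainsIn-⊆ : ∀ {X Y V} {H : V → V → Bool} → X ⊆ Y → ContainsIn T X H → ContainsIn T Y H
  ContainsIn-⊆ X⊆Y (f , f-inj , f∈ , f-arc) = f , f-inj , X⊆Y ∘ f∈ , f-arc

  ωLt-⊆ : ∀ {X Y a} → X ⊆ Y → ωLt T Y a → ωLt T X a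
  ωLt-⊆ X⊆Y (rank , ord , small) =
    rank , (λ u v u∈ v∈ → ord u v (X⊆Y u∈) (X⊆Y v∈)) ,
    λ K (K⊆X , back) → small K ((λ x∈ → X⊆Y (K⊆X x∈)) , back)

  ωGe-≤ : ∀ {X a b} → a ≤ b → ωGe T X b → ωGe T X a
  ωGe-≤ a≤b ge rank ord = let (K , clique , big) = ge rank ord in K , clique , ≤-trans a≤b big

  ωGe⇒¬ωLt : ∀ {X a} → ωGe T X a → ¬ ωLt T X a
  ωGe⇒¬ωLt ge (rank , ord , small) = let (K , clique , big) = ge rank ord in <⇒≱ (small K clique) big

  -- Y on the even ranks in the order r₁, everything else on the odd ranks
  -- in the order r₂: a back-clique then splits into one for each part.
  interleave : Subset N → (Fin N → ℕ) → (Fin N → ℕ) → Fin N → ℕ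
  interleave Y r₁ r₂ u with u ∈? Y
  ... | yes _ = 2 * r₁ u
  ... | no _  = suc (2 * r₂ u)

  interleave-∈ : ∀ {Y r₁ r₂ u} → u ∈ Y → interleave Y r₁ r₂ u ≡ 2 * r₁ u
  interleave-∈ {Y} {u = u} u∈Y with u ∈? Y
  ... | yes _ = refl
  ... | no u∉Y = contradiction u∈Y u∉Y

  interleave-∉ : ∀ {Y r₁ r₂ u} → u ∉ Y → interleave Y r₁ r₂ u ≡ suc (2 * r₂ u)
  interleave-∉ {Y} {u = u} u∉Y with u ∈? Y
  ... | yes u∈Y = contradiction u∈Y u∉Y
  ... | no _ = refl

  interleave-isOrdering : ∀ {Y Z r₁ r₂} → IsOrdering T Y r₁ → IsOrdering T Z r₂ →
                          IsOrdering T (Y ∪ Z) (interleave Y r₁ r₂)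
  interleave-isOrdering {Y} {Z} {r₁} {r₂} o₁ o₂ u v u∈ v∈ eq with u ∈? Y | v ∈? Y
  ... | yes u∈Y | yes v∈Y = o₁ u v u∈Y v∈Y (*-cancelˡ-≡ _ _ 2 eq)
  ... | yes _   | no _    = contradiction eq (even≢odd (r₁ u) (r₂ v))
  ... | no _    | yes _   = contradiction (sym eq) (even≢odd (r₁ v) (r₂ u))
  ... | no u∉Y  | no v∉Y  =
    o₂ u v (x∈p∪q∧x∉p⇒x∈q u∈ u∉Y) (x∈p∪q∧x∉p⇒x∈q v∈ v∉Y) (*-cancelˡ-≡ _ _ 2 (suc-injective eq))

  interleave-backClique₁ : ∀ {Y Z r₁ r₂ K} → BackClique T (Y ∪ Z) (interleave Y r₁ r₂) K →
                           BackClique T Y r₁ (K ∩ Y)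
  interleave-backClique₁ {Y} {K = K} (_ , back) = p∩q⊆q K Y , λ u v u∈ v∈ lt →
    let (u∈K , u∈Y) = x∈p∩q⁻ K Y u∈
        (v∈K , v∈Y) = x∈p∩q⁻ K Y v∈
    in back u v u∈K v∈K (subst₂ _<_ (sym (interleave-∈ u∈Y)) (sym (interleave-∈ v∈Y)) (*-monoʳ-< 2 lt))

  interleave-backClique₂ : ∀ {Y Z r₁ r₂ K} → BackClique T (Y ∪ Z) (interleave Y r₁ r₂) K →
                           BackClique T Z r₂ (K ∩ ∁ Y)
  interleave-backClique₂ {Y} {K = K} (K⊆ , back) =
    (λ u∈ → let (u∈K , u∉Y) = x∈p∩q⁻ K (∁ Y) u∈ in x∈p∪q∧x∉p⇒x∈q (K⊆ u∈K) (x∈∁p⇒x∉p u∉Y)) ,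
    λ u v u∈ v∈ lt →
    let (u∈K , u∉Y) = x∈p∩q⁻ K (∁ Y) u∈
        (v∈K , v∉Y) = x∈p∩q⁻ K (∁ Y) v∈
    in back u v u∈K v∈K (subst₂ _<_ (sym (interleave-∉ (x∈∁p⇒x∉p u∉Y))) (sym (interleave-∉ (x∈∁p⇒x∉p v∉Y)))
                                    (s≤s (*-monoʳ-< 2 lt)))

  ωLt-∪ : ∀ {Y Z a b} → ωLt T Y a → ωLt T Z b → ωLt T (Y ∪ Z) (a + b)
  ωLt-∪ {Y} (r₁ , o₁ , small₁) (r₂ , o₂ , small₂) =
    interleave Y r₁ r₂ , interleave-isOrdering o₁ o₂ , λ K clique →
      subst (_< _) (sym (∣p∣≡∣p∩q∣+∣p∩∁q∣ K Y))
        (+-mono-< (small₁ _ (interleave-backClique₁ clique)) (small₂ _ (interleave-backClique₂ clique)))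

  isOrdering? : ∀ X rank → Dec (IsOrdering T X rank)
  isOrdering? X rank = all? λ u → all? λ v →
    (u ∈? X) →-dec ((v ∈? X) →-dec ((rank u ≟ rank v) →-dec (u ≟ᶠ v)))

  backClique? : ∀ X rank K → Dec (BackClique T X rank K)
  backClique? X rank K = (K ⊆? X) ×-dec all? λ u → all? λ v →
    (u ∈? K) →-dec ((v ∈? K) →-dec ((rank u <? rank v) →-dec (arc T v u ≟ᵇ true)))

  bigBackClique? : ∀ X rank a → Dec (∃ λ K → BackClique T X rank K × a ≤ ∣ K ∣)
  bigBackClique? X rank a = anySubset? λ K → backClique? X rank K ×-dec (a ≤? ∣ K ∣)

  smallBackCliques? : ∀ X rank a → Dec (∀ K → BackClique T X rank K → ∣ K ∣ < a)
  smallBackCliques? X rank a =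
    map′ (λ ¬big K clique → ≰⇒> λ a≤ → ¬big (K , clique , a≤))
         (λ small (K , clique , a≤) → <⇒≱ (small K clique) a≤)
         (¬? (bigBackClique? X rank a))

  ¬ωLt⇒ωGe : ∀ {X a} → ¬ ωLt T X a → ωGe T X a
  ¬ωLt⇒ωGe {X} {a} ¬lt rank ord with bigBackClique? X rank a
  ... | yes big = big
  ... | no ¬big = contradiction (rank , ord , λ K clique → ≰⇒> λ a≤ → ¬big (K , clique , a≤)) ¬lt

  Preserves< : Subset N → (Fin N → ℕ) → (Fin N → ℕ) → Set
  Preserves< X rank rank′ = ∀ {u v} → u ∈ X → v ∈ X → rank u < rank v → rank′ u < rank′ v

  isOrdering-reindex : ∀ {X rank rank′} → Preserves< X rank rank′ →
                       IsOrdering T X rank → IsOrdering T X rank′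
  isOrdering-reindex {rank = rank} mono ord u v u∈ v∈ eq with <-cmp (rank u) (rank v)
  ... | tri< lt _ _ = contradiction eq (<⇒≢ (mono u∈ v∈ lt))
  ... | tri≈ _ e _  = ord u v u∈ v∈ e
  ... | tri> _ _ gt = contradiction (sym eq) (<⇒≢ (mono v∈ u∈ gt))

  backClique-reindex : ∀ {X rank rank′ K} → Preserves< X rank rank′ →
                       BackClique T X rank′ K → BackClique T X rank K
  backClique-reindex mono (K⊆X , back) =
    K⊆X , λ u v u∈ v∈ lt → back u v u∈ v∈ (mono (K⊆X u∈) (K⊆X v∈) lt)

  below? : (rank : Fin N → ℕ) (X : Subset N) (u y : Fin N) → Dec (y ∈ X × rank y < rank u)
  below? rank X u y = (y ∈? X) ×-dec (rank y <? rank u)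

  below : (Fin N → ℕ) → Subset N → Fin N → Subset N
  below rank X u = decSubset (below? rank X u)

  ∣below∣-preserves< : ∀ rank X → Preserves< X rank (λ u → ∣ below rank X u ∣)
  ∣below∣-preserves< rank X {u} {v} u∈X _ lt = p⊂q⇒∣p∣<∣q∣ (below-⊆ , u , ∈-decSubset⁺ (below? rank X v) (u∈X , lt) , u∉)
    where
    below-⊆ : below rank X u ⊆ below rank X v
    below-⊆ y∈ = let (y∈X , y<u) = ∈-decSubset⁻ (below? rank X u) y∈
                 in ∈-decSubset⁺ (below? rank X v) (y∈X , <-trans y<u lt)
    u∉ : u ∉ below rank X u
    u∉ u∈ = <-irrefl refl (proj₂ (∈-decSubset⁻ (below? rank X u) u∈))

  rankOf : ∀ {m} → Vec (Fin m) N → Fin N → ℕ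
  rankOf r u = toℕ (lookup r u)

  compress : (Fin N → ℕ) → Subset N → Vec (Fin (suc N)) N
  compress rank X = tabulate λ u → fromℕ< (s≤s (∣p∣≤n (below rank X u)))

  compress-preserves< : ∀ rank X → Preserves< X rank (rankOf (compress rank X))
  compress-preserves< rank X u∈ v∈ lt =
    subst₂ _<_ (sym (rankOf-compress _)) (sym (rankOf-compress _)) (∣below∣-preserves< rank X u∈ v∈ lt)
    where
    rankOf-compress : ∀ u → rankOf (compress rank X) u ≡ ∣ below rank X u ∣
    rankOf-compress u = trans (cong toℕ (lookup∘tabulate _ u)) (toℕ-fromℕ< _)

  -- Ranking by the number of elements of X below realises any ordering of X
  -- with ranks at most N, so only finitely many rank vectors need searching.
  ωLt? : ∀ X a → Dec (ωLt T X a)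
  ωLt? X a =
    map′ (λ (r , ord , small) → rankOf r , ord , small)
         (λ (rank , ord , small) →
            let mono = compress-preserves< rank X in
            compress rank X , isOrdering-reindex mono ord , λ K clique → small K (backClique-reindex mono clique))
         (anyVec? λ r → isOrdering? X (rankOf r) ×-dec smallBackCliques? X (rankOf r) a)

  ¬ωGe⇒ωLt : ∀ {X a} → ¬ ωGe T X a → ωLt T X a
  ¬ωGe⇒ωLt {X} {a} ¬ge with ωLt? X a
  ... | yes lt = lt
  ... | no ¬lt = contradiction (¬ωLt⇒ωGe ¬lt) ¬ge

  ωGe-cover : ∀ {S Y Z a b} → S ⊆ Y ∪ Z → ωLt T Y a → ωGe T S (a + b) → ωGe T Z b
  ωGe-cover S⊆ ltY geS = ¬ωLt⇒ωGe λ ltZ → ωGe⇒¬ωLt geS (ωLt-⊆ S⊆ (ωLt-∪ ltY ltZ))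

  ωGe-split : ∀ {S Y Z a b} → S ⊆ Y ∪ Z → ωGe T S (a + b) → ωGe T Y a ⊎ ωGe T Z b
  ωGe-split {Y = Y} {a = a} S⊆ geS with ωLt? Y a
  ... | yes ltY = inj₂ (ωGe-cover S⊆ ltY geS)
  ... | no ¬ltY = inj₁ (¬ωLt⇒ωGe ¬ltY)

∣D∣ : ℕ → ℕ
∣D∣ zero = 0
∣D∣ (suc k) = ∣D∣ k + ∣D∣ k + 1

suc-∣D∣ : ∀ k → suc (∣D∣ k) ≡ 2 ^ k
suc-∣D∣ zero = refl
suc-∣D∣ (suc k) = trans (double-suc (∣D∣ k)) (cong (2 *_) (suc-∣D∣ k))
  where
  double-suc : ∀ a → suc (a + a + 1) ≡ 2 * suc a
  double-suc = solve-∀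

[2*m]*n≡m*n+m*n : ∀ m n → 2 * m * n ≡ m * n + m * n
[2*m]*n≡m*n+m*n = solve-∀

module _ {N : ℕ} (T : Tournament N) where

  ⋃ᴰ : ∀ k → (DV (suc k) → Subset N) → Subset N
  ⋃ᴰ zero F = F d1
  ⋃ᴰ (suc k) F = (⋃ᴰ k (F ∘ left) ∪ ⋃ᴰ k (F ∘ right)) ∪ F w

  ∈⋃ᴰ : ∀ k F x {u} → u ∈ F x → u ∈ ⋃ᴰ k F
  ∈⋃ᴰ zero F d1 u∈ = u∈
  ∈⋃ᴰ (suc k) F (left x) u∈ = x∈p∪q⁺ (inj₁ (x∈p∪q⁺ (inj₁ (∈⋃ᴰ k (F ∘ left) x u∈))))
  ∈⋃ᴰ (suc k) F (right x) u∈ = x∈p∪q⁺ (inj₁ (x∈p∪q⁺ (inj₂ (∈⋃ᴰ k (F ∘ right) x u∈))))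
  ∈⋃ᴰ (suc k) F w u∈ = x∈p∪q⁺ (inj₂ u∈)

  ∉⋃ᴰ : ∀ k F {u} → u ∈ ∁ (⋃ᴰ k F) → ∀ x → u ∉ F x
  ∉⋃ᴰ k F u∉ x u∈ = x∈∁p⇒x∉p u∉ (∈⋃ᴰ k F x u∈)

  ⋃ᴰ-ωLt : ∀ k {F s} → (∀ x → ωLt T (F x) s) → ωLt T (⋃ᴰ k F) (∣D∣ (suc k) * s)
  ⋃ᴰ-ωLt zero {F} {s} small = subst (ωLt T (F d1)) (sym (*-identityˡ s)) (small d1)
  ⋃ᴰ-ωLt (suc k) {s = s} small =
    subst (ωLt T _) (sym (distrib (∣D∣ (suc k)) s))
      (ωLt-∪ T (ωLt-∪ T (⋃ᴰ-ωLt k (small ∘ left)) (⋃ᴰ-ωLt k (small ∘ right))) (small w))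
    where
    distrib : ∀ a s → (a + a + 1) * s ≡ a * s + a * s + s
    distrib = solve-∀

  D-join : ∀ {k v} (F : ContainsIn T (N⁺ T v) (D (suc k))) (G : ContainsIn T (N⁻ T v) (D (suc k))) →
           (∀ x y → Arc T (proj₁ F x) (proj₁ G y)) → Contains T (D (suc (suc k)))
  D-join {k} {v} (f , f-inj , f∈ , f-arc) (g , g-inj , g∈ , g-arc) f⇒g = h , h-inj , (λ _ → ∈⊤) , h-arc
    where
    v⇒f : ∀ x → Arc T v (f x)
    v⇒f x = ∈N⁺⇒Arc T (f∈ x)
    g⇒v : ∀ y → Arc T (g y) v
    g⇒v y = ∈N⁻⇒Arc T (g∈ y)
    h : DV (suc (suc k)) → Fin N
    h (left x) = f x
    h (right y) = g y
    h w = v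
    h-inj : ∀ x y → h x ≡ h y → x ≡ y
    h-inj (left x) (left x′) e = cong left (f-inj x x′ e)
    h-inj (right y) (right y′) e = cong right (g-inj y y′ e)
    h-inj w w _ = refl
    h-inj (left x) (right y) e = contradiction e (Arc⇒≢ T (f⇒g x y))
    h-inj (right y) (left x) e = contradiction (sym e) (Arc⇒≢ T (f⇒g x y))
    h-inj (left x) w e = contradiction (sym e) (Arc⇒≢ T (v⇒f x))
    h-inj w (left x) e = contradiction e (Arc⇒≢ T (v⇒f x))
    h-inj (right y) w e = contradiction e (Arc⇒≢ T (g⇒v y))
    h-inj w (right y) e = contradiction (sym e) (Arc⇒≢ T (g⇒v y))
    h-arc : ∀ x y → D (suc (suc k)) x y ≡ arc T (h x) (h y)
    h-arc (left x) (left x′) = f-arc x x′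
    h-arc (right y) (right y′) = g-arc y y′
    h-arc (left x) (right y) = sym (f⇒g x y)
    h-arc (right y) (left x) = sym (antisym T _ _ (f⇒g x y))
    h-arc (right y) w = sym (g⇒v y)
    h-arc w (right y) = sym (antisym T _ _ (g⇒v y))
    h-arc w (left x) = sym (v⇒f x)
    h-arc (left x) w = sym (antisym T _ _ (v⇒f x))
    h-arc w w = sym (irrefl T v)

module _ {N : ℕ} (T : Tournament N) {k s : ℕ}
         (rich : ∀ X → ωGe T X s → ContainsIn T X (D (suc k))) where

  copy-avoiding : ∀ {Y} (F : DV (suc k) → Subset N) → (∀ x → ωLt T (F x) s) →
                  ωGe T Y (2 ^ suc k * s) → ContainsIn T (Y ∩ ∁ (⋃ᴰ T k F)) (D (suc k))
  copy-avoiding {Y} F small geY =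
    rich _ (ωGe-cover T (p⊆q∪p∩∁q Y _) (⋃ᴰ-ωLt T k small) (subst (ωGe T Y) (sym size) geY))
    where
    size : ∣D∣ (suc k) * s + s ≡ 2 ^ suc k * s
    size = trans (+-comm _ s) (cong (_* s) (suc-∣D∣ (suc k)))

  copy-dominated : ∀ {X Y} → (∀ {u} → u ∈ X → u ∉ Y) → (∀ {u} → u ∈ X → ωLt T (N⁻ T u ∩ Y) s) →
                   ωGe T Y (2 ^ suc k * s) → (F : ContainsIn T X (D (suc k))) →
                   Σ (ContainsIn T Y (D (suc k))) λ G → ∀ x y → Arc T (proj₁ F x) (proj₁ G y)
  copy-dominated {Y = Y} X∉Y small geY (f , _ , f∈ , _)
    with copy-avoiding (λ x → N⁻ T (f x) ∩ Y) (λ x → small (f∈ x)) geY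
  ... | g , g-inj , g∈ , g-arc = (g , g-inj , g∈Y , g-arc) , f⇒g
    where
    g∈Y : ∀ y → g y ∈ Y
    g∈Y y = p∩q⊆p Y _ (g∈ y)
    f⇒g : ∀ x y → Arc T (f x) (g y)
    f⇒g x y = ∉N⁻⇒Arc T (λ g≡f → X∉Y (f∈ x) (subst (_∈ Y) g≡f (g∈Y y)))
      λ g∈N⁻ → ∉⋃ᴰ T k _ (p∩q⊆q Y _ (g∈ y)) x (x∈p∩q⁺ (g∈N⁻ , g∈Y y))

  copy-dominating : ∀ {X Y} → (∀ {u} → u ∈ X → u ∉ Y) → (∀ {u} → u ∈ X → ωLt T (N⁺ T u ∩ Y) s) →
                    ωGe T Y (2 ^ suc k * s) → (F : ContainsIn T X (D (suc k))) →
                    Σ (ContainsIn T Y (D (suc k))) λ G → ∀ x y → Arc T (proj₁ G y) (proj₁ F x)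
  copy-dominating {Y = Y} X∉Y small geY (f , _ , f∈ , _)
    with copy-avoiding (λ x → N⁺ T (f x) ∩ Y) (λ x → small (f∈ x)) geY
  ... | g , g-inj , g∈ , g-arc = (g , g-inj , g∈Y , g-arc) , g⇒f
    where
    g∈Y : ∀ y → g y ∈ Y
    g∈Y y = p∩q⊆p Y _ (g∈ y)
    g⇒f : ∀ x y → Arc T (g y) (f x)
    g⇒f x y = ∉N⁺⇒Arc T (λ g≡f → X∉Y (f∈ x) (subst (_∈ Y) g≡f (g∈Y y)))
      λ g∈N⁺ → ∉⋃ᴰ T k _ (p∩q⊆q Y _ (g∈ y)) x (x∈p∩q⁺ (g∈N⁺ , g∈Y y))

  D-above : ∀ {X Y v} → (∀ u → u ∈ X → ωLt T (N⁻ T u ∩ Y) s) →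
            ωGe T (X ∩ N⁺ T v) s → ωGe T (Y ∩ N⁻ T v) (2 ^ suc k * s) →
            Contains T (D (suc (suc k)))
  D-above {X} {Y} {v} X↛Y geX geY =
    let (G , f⇒g) = copy-dominated disjoint small geY F
    in D-join T (ContainsIn-⊆ T (p∩q⊆q X _) F) (ContainsIn-⊆ T (p∩q⊆q Y _) G) f⇒g
    where
    F : ContainsIn T (X ∩ N⁺ T v) (D (suc k))
    F = rich _ geX
    disjoint : ∀ {u} → u ∈ X ∩ N⁺ T v → u ∉ Y ∩ N⁻ T v
    disjoint u∈ u∈′ = N⁺-N⁻-disjoint T (p∩q⊆q X _ u∈) (p∩q⊆q Y _ u∈′) refl
    small : ∀ {u} → u ∈ X ∩ N⁺ T v → ωLt T (N⁻ T u ∩ (Y ∩ N⁻ T v)) s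
    small u∈ = ωLt-⊆ T (∩-monoʳ-⊆ _ (p∩q⊆p Y _)) (X↛Y _ (p∩q⊆p X _ u∈))

  D-below : ∀ {Y Z v} → (∀ u → u ∈ Z → ωLt T (N⁺ T u ∩ Y) s) →
            ωGe T (Z ∩ N⁻ T v) s → ωGe T (Y ∩ N⁺ T v) (2 ^ suc k * s) →
            Contains T (D (suc (suc k)))
  D-below {Y} {Z} {v} Y↚Z geZ geY =
    let (F , f⇒g) = copy-dominating disjoint small geY G
    in D-join T (ContainsIn-⊆ T (p∩q⊆q Y _) F) (ContainsIn-⊆ T (p∩q⊆q Z _) G) λ x y → f⇒g y x
    where
    G : ContainsIn T (Z ∩ N⁻ T v) (D (suc k))
    G = rich _ geZ
    disjoint : ∀ {u} → u ∈ Z ∩ N⁻ T v → u ∉ Y ∩ N⁺ T v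
    disjoint u∈ u∈′ = N⁺-N⁻-disjoint T (p∩q⊆q Y _ u∈′) (p∩q⊆q Z _ u∈) refl
    small : ∀ {u} → u ∈ Z ∩ N⁻ T v → ωLt T (N⁺ T u ∩ (Y ∩ N⁺ T v)) s
    small u∈ = ωLt-⊆ T (∩-monoʳ-⊆ _ (p∩q⊆p Y _)) (Y↚Z _ (p∩q⊆p Z _ u∈))

  D-from-bags : ∀ {X Y Z v} →
                (∀ u → u ∈ X → ωLt T (N⁻ T u ∩ Y) s) → (∀ u → u ∈ Z → ωLt T (N⁺ T u ∩ Y) s) →
                v ∉ Y → ωGe T Y (2 ^ suc (suc k) * s) →
                ωGe T (X ∩ N⁺ T v) s → ωGe T (Z ∩ N⁻ T v) s → Contains T (D (suc (suc k)))
  D-from-bags X↛Y Y↚Z v∉Y geY geX geZ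
    with ωGe-split T (⊆N⁺∪N⁻ T v∉Y) (subst (ωGe T _) ([2*m]*n≡m*n+m*n (2 ^ suc k) s) geY)
  ... | inj₁ geY⁺ = D-below Y↚Z geZ geY⁺
  ... | inj₂ geY⁻ = D-above X↛Y geX geY⁻

∃-between : ∀ {t} (i z : Fin t) → suc (toℕ i) < toℕ z → ∃ λ (M : Fin t) → toℕ i < toℕ M × toℕ M < toℕ z
∃-between i z i+1<z = M , subst (toℕ i <_) (sym M≡i+1) (n<1+n (toℕ i)) , subst (_< toℕ z) (sym M≡i+1) i+1<z
  where
  M = fromℕ< (<-trans i+1<z (toℕ<n z))
  M≡i+1 : toℕ M ≡ suc (toℕ i)
  M≡i+1 = toℕ-fromℕ< _

InZone⇒ωGe : ∀ {N} (T : Tournament N) {cs t B z v} → InZone T cs t B z v →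
             0 < toℕ z → ωGe T (B z ∩ N⁻ T v) cs
InZone⇒ωGe _ (_ , inj₁ (ge , _)) _ = ge
InZone⇒ωGe _ (_ , inj₂ (z≡0 , _)) 0<z = contradiction z≡0 (>⇒≢ 0<z)

InZone⇒¬ωGe : ∀ {N} (T : Tournament N) {cs t B z v} → InZone T cs t B z v →
              ∀ i → toℕ z < toℕ i → ¬ ωGe T (B i ∩ N⁻ T v) cs
InZone⇒¬ωGe _ (_ , inj₁ (_ , none)) = none
InZone⇒¬ωGe _ (_ , inj₂ (_ , none)) i _ = none i

lemma6p3 : (m n cs cl : ℕ) → 2 ≤ m → 2 ≤ n → 2 ^ n * cs ≤ cl →
  {N : ℕ} (T : Tournament N) →
  ¬ Contains T (A m) → ¬ Contains T (D n) →
  (∀ (X : Subset N) → ωGe T X cs →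
     ContainsIn T X (A (m ∸ 1)) × ContainsIn T X (D (n ∸ 1))) →
  (t : ℕ) (B : Fin t → Subset N) → IsMaxBagChain T cl cs t B →
  ∀ (i z : Fin t) (v : Fin N) → InZone T cs t B z v →
    (suc (suc (toℕ i)) ≤ toℕ z → ωLt T (B i ∩ N⁺ T v) cs) ×
    (toℕ z < toℕ i → ωLt T (B i ∩ N⁻ T v) cs)
lemma6p3 _ (suc zero) _ _ _ (s≤s ())
lemma6p3 _ (suc (suc k)) cs cl _ _ 2ⁿcs≤cl T _ noD rich t B ((_ , ωB , chain) , _) i z v v∈Z =
  far-before , far-after
  where
  far-after : toℕ z < toℕ i → ωLt T (B i ∩ N⁻ T v) cs
  far-after z<i = ¬ωGe⇒ωLt T (InZone⇒¬ωGe T v∈Z i z<i)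
  far-before : suc (suc (toℕ i)) ≤ toℕ z → ωLt T (B i ∩ N⁺ T v) cs
  far-before i+1<z with ∃-between i z i+1<z
  ... | M , i<M , M<z = ¬ωGe⇒ωLt T λ geI →
    noD (D-from-bags T (λ X → proj₂ ∘ rich X) (proj₂ (chain i M i<M)) (proj₁ (chain M z M<z))
           (proj₁ v∈Z M) (ωGe-≤ T 2ⁿcs≤cl (proj₁ (ωB M))) geI (InZone⇒ωGe T v∈Z (<-trans z<s i+1<z)))
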